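{- Let $n>1$, $q=2^n$, let $M$ be a field of characteristic $2$ that strictly contains $\mathbb{F}_{q^2}$, and let $u\in M\setminus\mathbb{F}_{q^2}$. Then the $q^2-1$ values $\langle \zeta u\rangle/w$, for $\zeta\in\mu_{q+1}$ and $w\in\mathbb{F}_q^\times$, are pairwise distinct (i.e. distinct pairs $(\zeta,w)$ give distinct values).
   Context: $\langle x\rangle$ denotes $x+1/x$. $\mu_{q+1}$ denotes the set of $(q+1)$-th roots of unity in an algebraic closure of $\mathbb{F}_2$; these lie in $\mathbb{F}_{q^2}\subset M$. -}

module Defs where

open import Level using (Level; suc; _⊔_)
open import Algebra.Bundles using (CommutativeRing)
open import Data.Nat using (ℕ; zero) renaming (suc to sucℕ)
open import Data.Fin using (Fin)
open import Relation.Nullary using (¬_)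
open import Relation.Binary.PropositionalEquality using (_≡_)

-- The inverse is a total operation with the
-- harmless convention 0⁻¹ = 0 (only inverses of nonzero elements are used).
record Field (c ℓ : Level) : Set (suc (c ⊔ ℓ)) where
  field
    commutativeRing : CommutativeRing c ℓ
  open CommutativeRing commutativeRing public
  infix 8 _⁻¹
  field
    _⁻¹      : Carrier → Carrier
    ⁻¹-cong  : ∀ {x y} → x ≈ y → x ⁻¹ ≈ y ⁻¹
    0≉1      : ¬ (0# ≈ 1#)
    inverseʳ : ∀ x → ¬ (x ≈ 0#) → x * x ⁻¹ ≈ 1#
    inv-zero : 0# ⁻¹ ≈ 0#

module FieldNotation {c ℓ : Level} (M : Field c ℓ) where
  open Field M public

  infixr 9 _^ᴹ_
  _^ᴹ_ : Carrier → ℕ → Carrier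
  x ^ᴹ zero = 1#
  x ^ᴹ sucℕ k = x * (x ^ᴹ k)

  _/ᴹ_ : Carrier → Carrier → Carrier
  x /ᴹ y = x * y ⁻¹

  ⟨_⟩ : Carrier → Carrier
  ⟨ x ⟩ = x + x ⁻¹

  HasChar2 : Set ℓ
  HasChar2 = 1# + 1# ≈ 0#

  -- membership in the subfield F_{Q} of M (Q a power of 2, M of char. 2),
  -- identified with the set of roots of X^Q - X in M
  InF : ℕ → Carrier → Set ℓ
  InF Q x = x ^ᴹ Q ≈ x

  InFˣ : ℕ → Carrier → Set ℓ
  InFˣ Q x = InF Q x × ¬ (x ≈ 0#)
    where open import Data.Product using (_×_)

  Inμ : ℕ → Carrier → Set ℓ
  Inμ N ζ = ζ ^ᴹ N ≈ 1#

  -- M contains (a copy of) F_Q: X^Q - X has Q distinct roots in M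
  ContainsF : ℕ → Set (c ⊔ ℓ)
  ContainsF Q = Σ (Fin Q → Carrier) λ f →
                  (∀ i → InF Q (f i)) × (∀ i j → f i ≈ f j → i ≡ j)
    where open import Data.Product using (Σ; _×_)

module Submission where

open import Defs
open import Data.Nat using (ℕ; _<_; _^_) renaming (_*_ to _*ℕ_; _+_ to _+ℕ_)
open import Data.Product using (_×_)
open import Relation.Nullary using (¬_)

open import Data.Nat using (zero; suc; pred; NonZero; ≢-nonZero)
open import Data.Nat.Properties using (m^n≢0; m*n≢0; m+1+n≢0; ^-distribˡ-+-*)
open import Data.Product using (∃; _,_; proj₁; proj₂)
open import Relation.Binary.PropositionalEquality as ≡ using (_≡_)
import Algebra.Properties.CommutativeSemiring.Exp as Exp
import Algebra.Solver.Ring.NaturalCoefficients.Default as RingSolver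
import Relation.Binary.Reasoning.Setoid as SetoidReasoning

-- Let q = 2ⁿ and put a = ζ₁u, b = ζ₂u.  Clearing denominators in
-- ⟨a⟩/w₁ = ⟨b⟩/w₂ gives w₂(a²b + b) = w₁(b²a + a); dividing by u and using
-- characteristic 2 this is the relation  A·u² = B  with
--   A = ζ₁ζ₂(w₂ζ₁ + w₁ζ₂),   B = w₂ζ₂ + w₁ζ₁.
-- Both ζᵢ ∈ μ_{q+1} and wᵢ ∈ F_q lie in F_{q²} = {x | x^{q²} = x}, hence so do
-- A and B.  Applying x ↦ x^{q²} to A·u² = B gives A·(u^{q²} + u)² = 0, and
-- u^{q²} ≠ u, so A = 0 and then B = 0.  The two linear relations
-- w₂ζ₁ = w₁ζ₂ and w₂ζ₂ = w₁ζ₁ give w₁² = w₂², so w₁ = w₂ and then ζ₁ = ζ₂.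

PowerOf2 : ℕ → Set
PowerOf2 Q = ∃ λ m → 2 ^ m ≡ Q

-- q² = 1 + (q + 1)(q - 1): the exponent identity behind μ_{q+1} ⊆ F_{q²}.
square≡1+[q+1][q-1] : ∀ q .{{_ : NonZero q}} → q *ℕ q ≡ suc ((q +ℕ 1) *ℕ pred q)
square≡1+[q+1][q-1] (suc p) =
  solve 1 (λ p → (con 1 :+ p) :* (con 1 :+ p) := con 1 :+ (con 1 :+ p :+ con 1) :* p) ≡.refl p
  where open import Data.Nat.Solver using (module +-*-Solver)
        open +-*-Solver

module Char2Field {c ℓ} (M : Field c ℓ) (char2 : FieldNotation.HasChar2 M) where
  open FieldNotation M
  open Exp commutativeSemiring using (^-congˡ; ^-assocʳ; ^-distrib-*) renaming (_^_ to _^ᶠ_)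
  open RingSolver commutativeSemiring
  open SetoidReasoning setoid

  ^ᴹ≈^ᶠ : ∀ x k → x ^ᴹ k ≈ x ^ᶠ k
  ^ᴹ≈^ᶠ x k = reflexive (^ᴹ≡^ᶠ k)
    where
    ^ᴹ≡^ᶠ : ∀ k → x ^ᴹ k ≡ x ^ᶠ k
    ^ᴹ≡^ᶠ zero = ≡.refl
    ^ᴹ≡^ᶠ (suc k) = ≡.cong (x *_) (^ᴹ≡^ᶠ k)

  ^ᴹ-congˡ : ∀ k {x y} → x ≈ y → x ^ᴹ k ≈ y ^ᴹ k
  ^ᴹ-congˡ k {x} {y} x≈y = begin
    x ^ᴹ k   ≈⟨ ^ᴹ≈^ᶠ x k ⟩
    x ^ᶠ k   ≈⟨ ^-congˡ k x≈y ⟩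
    y ^ᶠ k   ≈⟨ ^ᴹ≈^ᶠ y k ⟨
    y ^ᴹ k   ∎

  ^ᴹ-distrib-* : ∀ x y k → (x * y) ^ᴹ k ≈ x ^ᴹ k * y ^ᴹ k
  ^ᴹ-distrib-* x y k = begin
    (x * y) ^ᴹ k      ≈⟨ ^ᴹ≈^ᶠ (x * y) k ⟩
    (x * y) ^ᶠ k      ≈⟨ ^-distrib-* x y k ⟩
    x ^ᶠ k * y ^ᶠ k   ≈⟨ *-cong (^ᴹ≈^ᶠ x k) (^ᴹ≈^ᶠ y k) ⟨
    x ^ᴹ k * y ^ᴹ k   ∎

  ^ᴹ-assocʳ : ∀ x m k → (x ^ᴹ m) ^ᴹ k ≈ x ^ᴹ (m *ℕ k)
  ^ᴹ-assocʳ x m k = begin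
    (x ^ᴹ m) ^ᴹ k   ≈⟨ ^ᴹ-congˡ k (^ᴹ≈^ᶠ x m) ⟩
    (x ^ᶠ m) ^ᴹ k   ≈⟨ ^ᴹ≈^ᶠ (x ^ᶠ m) k ⟩
    (x ^ᶠ m) ^ᶠ k   ≈⟨ ^-assocʳ x m k ⟩
    x ^ᶠ (m *ℕ k)   ≈⟨ ^ᴹ≈^ᶠ x (m *ℕ k) ⟨
    x ^ᴹ (m *ℕ k)   ∎

  1^ᴹ : ∀ k → 1# ^ᴹ k ≈ 1#
  1^ᴹ zero = refl
  1^ᴹ (suc k) = trans (*-identityˡ _) (1^ᴹ k)

  ^ᴹ2 : ∀ x → x ^ᴹ 2 ≈ x * x
  ^ᴹ2 x = *-congˡ (*-identityʳ x)

  zero-power : ∀ Q .{{_ : NonZero Q}} {x} → x ≈ 0# → x ^ᴹ Q ≈ 0#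
  zero-power (suc k) x≈0 = trans (*-congʳ x≈0) (zeroˡ _)

  x+x≈0 : ∀ x → x + x ≈ 0#
  x+x≈0 x = begin
    x + x              ≈⟨ +-cong (*-identityˡ x) (*-identityˡ x) ⟨
    1# * x + 1# * x    ≈⟨ distribʳ x 1# 1# ⟨
    (1# + 1#) * x      ≈⟨ *-congʳ char2 ⟩
    0# * x             ≈⟨ zeroˡ x ⟩
    0#                 ∎

  +≈0⇒≈ : ∀ {a b} → a + b ≈ 0# → a ≈ b
  +≈0⇒≈ {a} {b} a+b≈0 = begin
    a              ≈⟨ +-identityʳ a ⟨
    a + 0#         ≈⟨ +-congˡ (x+x≈0 b) ⟨
    a + (b + b)    ≈⟨ +-assoc a b b ⟨
    (a + b) + b    ≈⟨ +-congʳ a+b≈0 ⟩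
    0# + b         ≈⟨ +-identityˡ b ⟩
    b              ∎

  ≈⇒+≈0 : ∀ {a b} → a ≈ b → a + b ≈ 0#
  ≈⇒+≈0 {b = b} a≈b = trans (+-congʳ a≈b) (x+x≈0 b)

  square-+ : ∀ x y → (x + y) * (x + y) ≈ x * x + y * y
  square-+ x y = begin
    (x + y) * (x + y)                ≈⟨ solve 2 (λ x y → (x :+ y) :* (x :+ y) := x :* x :+ y :* y :+ (x :* y :+ x :* y)) refl x y ⟩
    x * x + y * y + (x * y + x * y)  ≈⟨ +-congˡ (x+x≈0 _) ⟩
    x * x + y * y + 0#               ≈⟨ +-identityʳ _ ⟩
    x * x + y * y                    ∎

  frobenius : ∀ m x y → (x + y) ^ᴹ (2 ^ m) ≈ x ^ᴹ (2 ^ m) + y ^ᴹ (2 ^ m)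
  frobenius zero x y = trans (*-identityʳ _) (sym (+-cong (*-identityʳ x) (*-identityʳ y)))
  frobenius (suc m) x y = begin
    (x + y) ^ᴹ (2 *ℕ 2 ^ m)                    ≈⟨ ^ᴹ-assocʳ (x + y) 2 (2 ^ m) ⟨
    ((x + y) ^ᴹ 2) ^ᴹ (2 ^ m)                  ≈⟨ ^ᴹ-congˡ (2 ^ m) square-+ᴹ ⟩
    (x ^ᴹ 2 + y ^ᴹ 2) ^ᴹ (2 ^ m)               ≈⟨ frobenius m (x ^ᴹ 2) (y ^ᴹ 2) ⟩
    (x ^ᴹ 2) ^ᴹ (2 ^ m) + (y ^ᴹ 2) ^ᴹ (2 ^ m)  ≈⟨ +-cong (^ᴹ-assocʳ x 2 (2 ^ m)) (^ᴹ-assocʳ y 2 (2 ^ m)) ⟩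
    x ^ᴹ (2 *ℕ 2 ^ m) + y ^ᴹ (2 *ℕ 2 ^ m)      ∎
    where
    square-+ᴹ : (x + y) ^ᴹ 2 ≈ x ^ᴹ 2 + y ^ᴹ 2
    square-+ᴹ = trans (^ᴹ2 (x + y)) (trans (square-+ x y) (sym (+-cong (^ᴹ2 x) (^ᴹ2 y))))

  *-cancelˡ : ∀ {a x y} → ¬ a ≈ 0# → a * x ≈ a * y → x ≈ y
  *-cancelˡ {a} {x} {y} a≉0 ax≈ay = begin
    x                ≈⟨ *-identityˡ x ⟨
    1# * x           ≈⟨ *-congʳ a⁻¹a≈1 ⟨
    (a ⁻¹ * a) * x   ≈⟨ *-assoc _ _ _ ⟩
    a ⁻¹ * (a * x)   ≈⟨ *-congˡ ax≈ay ⟩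
    a ⁻¹ * (a * y)   ≈⟨ *-assoc _ _ _ ⟨
    (a ⁻¹ * a) * y   ≈⟨ *-congʳ a⁻¹a≈1 ⟩
    1# * y           ≈⟨ *-identityˡ y ⟩
    y                ∎
    where
    a⁻¹a≈1 : a ⁻¹ * a ≈ 1#
    a⁻¹a≈1 = trans (*-comm _ _) (inverseʳ a a≉0)

  *-≉0 : ∀ {x y} → ¬ x ≈ 0# → ¬ y ≈ 0# → ¬ x * y ≈ 0#
  *-≉0 {x} {y} x≉0 y≉0 xy≈0 = x≉0 (*-cancelˡ y≉0 (trans (*-comm y x) (trans xy≈0 (sym (zeroʳ y)))))

  ∉F⇒≉0 : ∀ Q .{{_ : NonZero Q}} {x} → ¬ InF Q x → ¬ x ≈ 0#
  ∉F⇒≉0 Q x∉F x≈0 = x∉F (trans (zero-power Q x≈0) (sym x≈0))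

  μ⇒≉0 : ∀ N .{{_ : NonZero N}} {ζ} → Inμ N ζ → ¬ ζ ≈ 0#
  μ⇒≉0 N ζ∈μ ζ≈0 = 0≉1 (trans (sym (zero-power N ζ≈0)) ζ∈μ)

  InF-* : ∀ Q {x y} → InF Q x → InF Q y → InF Q (x * y)
  InF-* Q {x} {y} x∈F y∈F = trans (^ᴹ-distrib-* x y Q) (*-cong x∈F y∈F)

  InF-+ : ∀ {Q x y} → PowerOf2 Q → InF Q x → InF Q y → InF Q (x + y)
  InF-+ {x = x} {y} (m , ≡.refl) x∈F y∈F = trans (frobenius m x y) (+-cong x∈F y∈F)

  InF-*ℕ : ∀ Q R {x} → InF Q x → InF R x → InF (Q *ℕ R) x
  InF-*ℕ Q R {x} x∈FQ x∈FR = begin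
    x ^ᴹ (Q *ℕ R)    ≈⟨ ^ᴹ-assocʳ x Q R ⟨
    (x ^ᴹ Q) ^ᴹ R    ≈⟨ ^ᴹ-congˡ R x∈FQ ⟩
    x ^ᴹ R           ≈⟨ x∈FR ⟩
    x                ∎

  μ⊆F : ∀ {N ζ} k → Inμ N ζ → InF (suc (N *ℕ k)) ζ
  μ⊆F {N} {ζ} k ζ∈μ = begin
    ζ * ζ ^ᴹ (N *ℕ k)     ≈⟨ *-congˡ (^ᴹ-assocʳ ζ N k) ⟨
    ζ * (ζ ^ᴹ N) ^ᴹ k     ≈⟨ *-congˡ (^ᴹ-congˡ k ζ∈μ) ⟩
    ζ * 1# ^ᴹ k           ≈⟨ *-congˡ (1^ᴹ k) ⟩
    ζ * 1#                ≈⟨ *-identityʳ ζ ⟩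
    ζ                     ∎

  μ[q+1]⊆F[q²] : ∀ q .{{_ : NonZero q}} {ζ} → Inμ (q +ℕ 1) ζ → InF (q *ℕ q) ζ
  μ[q+1]⊆F[q²] q {ζ} ζ∈μ =
    ≡.subst (λ Q → InF Q ζ) (≡.sym (square≡1+[q+1][q-1] q)) (μ⊆F {q +ℕ 1} (pred q) ζ∈μ)

  -- Squaring is injective on F_Q for Q = 2^{m+1}: a square root of 0 in F_Q is
  -- a power of its square, hence 0.
  square-injective : ∀ m {x y} → InF (2 ^ suc m) x → InF (2 ^ suc m) y → x * x ≈ y * y → x ≈ y
  square-injective m {x} {y} x∈F y∈F xx≈yy = +≈0⇒≈ (begin
    z                        ≈⟨ z∈F ⟨
    z ^ᴹ (2 *ℕ 2 ^ m)        ≈⟨ ^ᴹ-assocʳ z 2 (2 ^ m) ⟨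
    (z ^ᴹ 2) ^ᴹ (2 ^ m)      ≈⟨ zero-power (2 ^ m) {{m^n≢0 2 m}} z²≈0 ⟩
    0#                       ∎)
    where
    z : Carrier
    z = x + y
    z∈F : InF (2 ^ suc m) z
    z∈F = InF-+ (suc m , ≡.refl) x∈F y∈F
    z²≈0 : z ^ᴹ 2 ≈ 0#
    z²≈0 = trans (^ᴹ2 z) (trans (square-+ x y) (≈⇒+≈0 xx≈yy))

  -- Key step: a relation A·u² = B with A, B ∈ F_Q and u ∉ F_Q forces A = 0,
  -- and then B = 0.  Raising to the Q-th power gives A·(u^Q)² = B = A·u², so
  -- A·(u^Q + u)² = 0 with u^Q + u ≠ 0.
  coefficients-vanish : ∀ Q {A B u} → InF Q A → InF Q B → ¬ InF Q u →
                        A * (u * u) ≈ B → (A ≈ 0#) × (B ≈ 0#)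
  coefficients-vanish Q {A} {B} {u} A∈F B∈F u∉F Au²≈B =
    A≈0 , trans (sym Au²≈B) (trans (*-congʳ A≈0) (zeroˡ _))
    where
    v d : Carrier
    v = u ^ᴹ Q
    d = v + u
    d≉0 : ¬ d ≈ 0#
    d≉0 d≈0 = u∉F (+≈0⇒≈ d≈0)
    Av²≈Au² : A * (v * v) ≈ A * (u * u)
    Av²≈Au² = begin
      A * (v * v)             ≈⟨ *-congʳ A∈F ⟨
      A ^ᴹ Q * (v * v)        ≈⟨ *-congˡ (^ᴹ-distrib-* u u Q) ⟨
      A ^ᴹ Q * (u * u) ^ᴹ Q   ≈⟨ ^ᴹ-distrib-* A (u * u) Q ⟨
      (A * (u * u)) ^ᴹ Q      ≈⟨ ^ᴹ-congˡ Q Au²≈B ⟩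
      B ^ᴹ Q                  ≈⟨ B∈F ⟩
      B                       ≈⟨ Au²≈B ⟨
      A * (u * u)             ∎
    A≈0 : A ≈ 0#
    A≈0 = *-cancelˡ (*-≉0 d≉0 d≉0) (begin
      (d * d) * A                  ≈⟨ *-comm _ _ ⟩
      A * (d * d)                  ≈⟨ *-congˡ (square-+ v u) ⟩
      A * (v * v + u * u)          ≈⟨ distribˡ A _ _ ⟩
      A * (v * v) + A * (u * u)    ≈⟨ ≈⇒+≈0 Av²≈Au² ⟩
      0#                           ≈⟨ zeroʳ _ ⟨
      (d * d) * 0#                 ∎)

  clear-denominator : ∀ {a w} v b → ¬ a ≈ 0# → ¬ w ≈ 0# →
                      ⟨ a ⟩ /ᴹ w * (w * v * a * b) ≈ v * (a * a * b + b)
  clear-denominator {a} {w} v b a≉0 w≉0 = begin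
    (a + a ⁻¹) * w ⁻¹ * (w * v * a * b)
      ≈⟨ solve 6 (λ a a⁻¹ w⁻¹ w v b → (a :+ a⁻¹) :* w⁻¹ :* (w :* v :* a :* b)
                   := (w :* w⁻¹) :* (v :* (a :* a :* b :+ (a :* a⁻¹) :* b))) refl a (a ⁻¹) (w ⁻¹) w v b ⟩
    (w * w ⁻¹) * (v * (a * a * b + (a * a ⁻¹) * b))
      ≈⟨ *-cong (inverseʳ w w≉0) (*-congˡ (+-congˡ (trans (*-congʳ (inverseʳ a a≉0)) (*-identityˡ b)))) ⟩
    1# * (v * (a * a * b + b))
      ≈⟨ *-identityˡ _ ⟩
    v * (a * a * b + b) ∎

  cross-multiply : ∀ {a b w₁ w₂} → ¬ a ≈ 0# → ¬ b ≈ 0# → ¬ w₁ ≈ 0# → ¬ w₂ ≈ 0# →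
                   ⟨ a ⟩ /ᴹ w₁ ≈ ⟨ b ⟩ /ᴹ w₂ → w₂ * (a * a * b + b) ≈ w₁ * (b * b * a + a)
  cross-multiply {a} {b} {w₁} {w₂} a≉0 b≉0 w₁≉0 w₂≉0 H = begin
    w₂ * (a * a * b + b)                ≈⟨ clear-denominator w₂ b a≉0 w₁≉0 ⟨
    ⟨ a ⟩ /ᴹ w₁ * (w₁ * w₂ * a * b)     ≈⟨ *-cong H (solve 4 (λ w₁ w₂ a b → w₁ :* w₂ :* a :* b := w₂ :* w₁ :* b :* a) refl w₁ w₂ a b) ⟩
    ⟨ b ⟩ /ᴹ w₂ * (w₂ * w₁ * b * a)     ≈⟨ clear-denominator w₁ a b≉0 w₂≉0 ⟩
    w₁ * (b * b * a + a)                ∎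

  coefficients∈F : ∀ {Q ζ₁ ζ₂ w₁ w₂} → PowerOf2 Q →
                   InF Q ζ₁ → InF Q ζ₂ → InF Q w₁ → InF Q w₂ →
                   InF Q (ζ₁ * ζ₂ * (w₂ * ζ₁ + w₁ * ζ₂)) × InF Q (w₂ * ζ₂ + w₁ * ζ₁)
  coefficients∈F (m , ≡.refl) ζ₁∈F ζ₂∈F w₁∈F w₂∈F =
    InF-* Q (InF-* Q ζ₁∈F ζ₂∈F) (F-+ (InF-* Q w₂∈F ζ₁∈F) (InF-* Q w₁∈F ζ₂∈F)) ,
    F-+ (InF-* Q w₂∈F ζ₂∈F) (InF-* Q w₁∈F ζ₁∈F)
    where
    Q : ℕ
    Q = 2 ^ m
    F-+ : ∀ {x y} → InF Q x → InF Q y → InF Q (x + y)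
    F-+ = InF-+ (m , ≡.refl)

  quadratic-relation : ∀ {u ζ₁ ζ₂ w₁ w₂} → ¬ u ≈ 0# → ¬ ζ₁ ≈ 0# → ¬ ζ₂ ≈ 0# →
                       ¬ w₁ ≈ 0# → ¬ w₂ ≈ 0# → ⟨ ζ₁ * u ⟩ /ᴹ w₁ ≈ ⟨ ζ₂ * u ⟩ /ᴹ w₂ →
                       ζ₁ * ζ₂ * (w₂ * ζ₁ + w₁ * ζ₂) * (u * u) ≈ w₂ * ζ₂ + w₁ * ζ₁
  quadratic-relation {u} {ζ₁} {ζ₂} {w₁} {w₂} u≉0 ζ₁≉0 ζ₂≉0 w₁≉0 w₂≉0 H =
    +≈0⇒≈ (*-cancelˡ u≉0 (begin
      u * (ζ₁ * ζ₂ * (w₂ * ζ₁ + w₁ * ζ₂) * (u * u) + (w₂ * ζ₂ + w₁ * ζ₁))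
        ≈⟨ solve 5 (λ z₁ z₂ u v₁ v₂ →
             u :* (z₁ :* z₂ :* (v₂ :* z₁ :+ v₁ :* z₂) :* (u :* u) :+ (v₂ :* z₂ :+ v₁ :* z₁))
             := v₂ :* ((z₁ :* u) :* (z₁ :* u) :* (z₂ :* u) :+ z₂ :* u)
                :+ v₁ :* ((z₂ :* u) :* (z₂ :* u) :* (z₁ :* u) :+ z₁ :* u)) refl ζ₁ ζ₂ u w₁ w₂ ⟩
      w₂ * (a * a * b + b) + w₁ * (b * b * a + a)
        ≈⟨ ≈⇒+≈0 (cross-multiply (*-≉0 ζ₁≉0 u≉0) (*-≉0 ζ₂≉0 u≉0) w₁≉0 w₂≉0 H) ⟩
      0#
        ≈⟨ zeroʳ u ⟨
      u * 0# ∎))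
    where
    a b : Carrier
    a = ζ₁ * u
    b = ζ₂ * u

  -- Vanishing of A = ζ₁ζ₂(w₂ζ₁ + w₁ζ₂) and B = w₂ζ₂ + w₁ζ₁ gives the linear
  -- relations w₂ζ₁ = w₁ζ₂ and w₂ζ₂ = w₁ζ₁, hence ζ₁ζ₂w₁² = ζ₁ζ₂w₂²; so w₁ = w₂
  -- (squaring is injective on F_q) and then ζ₁ = ζ₂.
  vanishing⇒equal : ∀ m {ζ₁ ζ₂ w₁ w₂} → ¬ ζ₁ ≈ 0# → ¬ ζ₂ ≈ 0# → ¬ w₂ ≈ 0# →
                    InF (2 ^ suc m) w₁ → InF (2 ^ suc m) w₂ →
                    ζ₁ * ζ₂ * (w₂ * ζ₁ + w₁ * ζ₂) ≈ 0# → w₂ * ζ₂ + w₁ * ζ₁ ≈ 0# →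
                    (ζ₁ ≈ ζ₂) × (w₁ ≈ w₂)
  vanishing⇒equal m {ζ₁} {ζ₂} {w₁} {w₂} ζ₁≉0 ζ₂≉0 w₂≉0 w₁∈F w₂∈F A≈0 B≈0 = ζ₁≈ζ₂ , w₁≈w₂
    where
    rel₁ : w₂ * ζ₁ ≈ w₁ * ζ₂
    rel₁ = +≈0⇒≈ (*-cancelˡ (*-≉0 ζ₁≉0 ζ₂≉0) (trans A≈0 (sym (zeroʳ _))))
    rel₂ : w₂ * ζ₂ ≈ w₁ * ζ₁
    rel₂ = +≈0⇒≈ B≈0
    w₁≈w₂ : w₁ ≈ w₂
    w₁≈w₂ = square-injective m w₁∈F w₂∈F (*-cancelˡ (*-≉0 ζ₁≉0 ζ₂≉0) (begin
      (ζ₁ * ζ₂) * (w₁ * w₁)    ≈⟨ solve 3 (λ z₁ z₂ v → (z₁ :* z₂) :* (v :* v) := (v :* z₂) :* (v :* z₁)) refl ζ₁ ζ₂ w₁ ⟩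
      (w₁ * ζ₂) * (w₁ * ζ₁)    ≈⟨ *-cong rel₁ rel₂ ⟨
      (w₂ * ζ₁) * (w₂ * ζ₂)    ≈⟨ solve 3 (λ z₁ z₂ v → (v :* z₁) :* (v :* z₂) := (z₁ :* z₂) :* (v :* v)) refl ζ₁ ζ₂ w₂ ⟩
      (ζ₁ * ζ₂) * (w₂ * w₂)    ∎))
    ζ₁≈ζ₂ : ζ₁ ≈ ζ₂
    ζ₁≈ζ₂ = *-cancelˡ w₂≉0 (trans rel₁ (*-congʳ w₁≈w₂))

lemma2p3 : ∀ {c ℓ} (M : Field c ℓ) → let open FieldNotation M in
    (n : ℕ) → 1 < n → HasChar2 → ContainsF ((2 ^ n) *ℕ (2 ^ n)) →
    (u : Carrier) → ¬ InF ((2 ^ n) *ℕ (2 ^ n)) u →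
    ∀ ζ₁ ζ₂ w₁ w₂ → Inμ (2 ^ n +ℕ 1) ζ₁ → Inμ (2 ^ n +ℕ 1) ζ₂ →
    InFˣ (2 ^ n) w₁ → InFˣ (2 ^ n) w₂ →
    ⟨ ζ₁ * u ⟩ /ᴹ w₁ ≈ ⟨ ζ₂ * u ⟩ /ᴹ w₂ → (ζ₁ ≈ ζ₂) × (w₁ ≈ w₂)
lemma2p3 M zero ()   -- n ≥ 1 is what the proof needs (so that q ≥ 2)
lemma2p3 M (suc n) _ char2 _ u u∉F ζ₁ ζ₂ w₁ w₂ ζ₁∈μ ζ₂∈μ (w₁∈F , w₁≉0) (w₂∈F , w₂≉0) H =
  vanishing⇒equal n ζ₁≉0 ζ₂≉0 w₂≉0 w₁∈F w₂∈F (proj₁ A,B≈0) (proj₂ A,B≈0)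
  where
  open FieldNotation M
  open Char2Field M char2
  q K : ℕ
  q = 2 ^ suc n
  K = q *ℕ q
  instance
    q≢0 : NonZero q
    q≢0 = m^n≢0 2 (suc n)
    q+1≢0 : NonZero (q +ℕ 1)
    q+1≢0 = ≢-nonZero (m+1+n≢0 q {0})
    K≢0 : NonZero K
    K≢0 = m*n≢0 q q
  ζ₁≉0 : ¬ ζ₁ ≈ 0#
  ζ₁≉0 = μ⇒≉0 (q +ℕ 1) ζ₁∈μ
  ζ₂≉0 : ¬ ζ₂ ≈ 0#
  ζ₂≉0 = μ⇒≉0 (q +ℕ 1) ζ₂∈μ
  A B : Carrier
  A = ζ₁ * ζ₂ * (w₂ * ζ₁ + w₁ * ζ₂)
  B = w₂ * ζ₂ + w₁ * ζ₁
  -- ζᵢ ∈ μ_{q+1} ⊆ F_{q²} and wᵢ ∈ F_q ⊆ F_{q²}, so A, B ∈ F_{q²}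
  A,B∈F : InF K A × InF K B
  A,B∈F = coefficients∈F (suc n +ℕ suc n , ^-distribˡ-+-* 2 (suc n) (suc n))
            (μ[q+1]⊆F[q²] q ζ₁∈μ) (μ[q+1]⊆F[q²] q ζ₂∈μ)
            (InF-*ℕ q q w₁∈F w₁∈F) (InF-*ℕ q q w₂∈F w₂∈F)
  A,B≈0 : (A ≈ 0#) × (B ≈ 0#)
  A,B≈0 = coefficients-vanish K (proj₁ A,B∈F) (proj₂ A,B∈F) u∉F
            (quadratic-relation (∉F⇒≉0 K u∉F) ζ₁≉0 ζ₂≉0 w₁≉0 w₂≉0 H)
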